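{- For every integer $k\ge1$ there exists a function $f_k$ such that every $k$-uniform hypergraph $H$ has an $\ell$-kernel of size at most $f_k(\ell)$, for every integer $\ell\ge1$.
   Context: $H=(V,E)$ is $k$-uniform if all edges have exactly $k$ vertices. An $\ell$-sunflower of $H$ is a multiset $S$ of $\ell$ edges of $H$ pairwise intersecting exactly in a fixed set $C$ (its center); its petals are the sets $s\setminus C$, $s\in S$. Multisets are allowed, so a single edge repeated $\ell$ times is an $\ell$-sunflower with that edge as center. $S$ is outside $Y\subseteq V$ if all its petals are disjoint from $Y$. A set $K\subseteq V$ is an $\ell$-kernel of $H$ if for every edge $e\in E$ there exist $C\subseteq e\cap K$ and an $\ell$-sunflower of $H$ outside $K$ with center $C$. -}

module Defs where

open import Data.Nat using (ℕ; _≤_)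
open import Data.Fin using (Fin)
open import Data.Fin.Subset using (Subset; _∩_; _─_; _⊆_; ∣_∣; Empty)
open import Data.List using (List)
open import Data.List.Relation.Unary.All using (All)
import Data.List.Membership.Propositional as L
open import Data.Product using (Σ; _×_)
open import Relation.Binary.PropositionalEquality using (_≡_; _≢_)

-- A (finite) hypergraph on vertex set Fin n; edges are subsets of Fin n,
-- given as a list (the edge set E is the set of list elements).
record Hypergraph : Set where
  constructor hypergraph
  field
    n     : ℕ
    edges : List (Subset n)

open Hypergraph public

IsEdge : (H : Hypergraph) → Subset (n H) → Set
IsEdge H e = e L.∈ edges H

Uniform : ℕ → Hypergraph → Set
Uniform k H = All (λ e → ∣ e ∣ ≡ k) (edges H)

-- An ℓ-sunflower with center C: a multiset of ℓ edges, given as a family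
-- S : Fin ℓ → edges (repetitions allowed), each containing C, and any two
-- members with distinct indices intersect exactly in C.
record Sunflower (H : Hypergraph) (ℓ : ℕ) (C : Subset (n H)) : Set where
  constructor sunflower
  field
    member     : Fin ℓ → Subset (n H)
    isEdge     : ∀ i → IsEdge H (member i)
    centerSub  : ∀ i → C ⊆ member i
    pairwise   : ∀ i j → i ≢ j → member i ∩ member j ≡ C

petal : ∀ {H ℓ C} → Sunflower H ℓ C → Fin ℓ → Subset (n H)
petal {C = C} S i = Sunflower.member S i ─ C

Outside : ∀ {H ℓ C} → Sunflower H ℓ C → Subset (n H) → Set
Outside S Y = ∀ i → Empty (petal S i ∩ Y)

IsKernel : (H : Hypergraph) → ℕ → Subset (n H) → Set
IsKernel H ℓ K =
  ∀ e → IsEdge H e →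
    Σ (Subset (n H)) λ C → C ⊆ (e ∩ K) ×
      Σ (Sunflower H ℓ C) λ S → Outside S K

-- Generalise to a common kernel K for a list of at most m base sets B, each such that every
-- edge through B has at most d vertices outside B, and induct on d.  For each B, greedily pick
-- edges through B with pairwise disjoint petals; they form a sunflower with center B, of size
-- s(B).  The thresholds T i are spaced so that, by pigeonhole, some window [T i, T (1+i))
-- contains no s(B).  A rich B (s(B) ≥ T (1+i)) keeps an ℓ-sunflower with center B after
-- dropping the at most ∣ K ∣ petals that meet K.  For a poor B (s(B) < T i) the union of its
-- petals is small, and by maximality it meets e ─ B, say in v, for every edge e ⊈ B through B;
-- then e passes through B ∪ {v}, which has one fewer free vertex.  The induction hypothesis for
-- all these B ∪ {v}, with ℓ enlarged by the size of the union U of the poor petals, gives K′,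
-- and K = U ∪ K′.
module Submission where

open import Defs
open import Data.Nat using (ℕ; zero; suc; _+_; _*_; _≤_; _<_; z≤n; s≤s; _≤?_; _<?_)
open import Data.Nat.Properties hiding (_≟_; suc-injective)
open import Data.Fin using (Fin; zero; suc; lift; _≟_)
open import Data.Fin.Properties using (lift-injective; suc-injective)
open import Data.Vec using ([]; _∷_; here; there)
open import Data.Fin.Subset
open import Data.Fin.Subset.Properties
open import Data.List using (List; []; _∷_; _++_; length; lookup; map; filter; concatMap; upTo)
open import Data.List.Properties using (length-map; length-++; length-filter; filter-notAll)
open import Data.List.Extrema.Nat using (max; xs≤max)
import Data.List.Membership.Propositional as L
open import Data.List.Membership.Propositional.Properties
  using (∈-map⁺; ∈-map⁻; ∈-filter⁺; ∈-filter⁻; ∈-concat⁺′; ∈-lookup; ∈-upTo⁺)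
open import Data.List.Relation.Unary.All as All using (All; []; _∷_; all?)
open import Data.List.Relation.Unary.All.Properties using (¬All⇒Any¬; concat⁺; map⁺)
open import Data.List.Relation.Unary.AllPairs using (AllPairs; []; _∷_)
open import Data.List.Relation.Unary.Any using (here; there)
open import Data.Product using (Σ; _×_; _,_; proj₁; proj₂; ∃-syntax)
open import Data.Sum using (_⊎_; inj₁; inj₂; [_,_])
open import Function using (_∘_)
open import Function.Definitions using (Injective)
open import Relation.Nullary using (Dec; yes; no; contradiction)
open import Relation.Nullary.Decidable using (_×-dec_; ¬?)
open import Relation.Binary.PropositionalEquality using (_≡_; _≢_; refl; sym; trans; cong; subst)

private variable
  k : ℕ
  p q r : Subset k
  x : Fin k

Disjoint : Subset k → Subset k → Set
Disjoint p q = Empty (p ∩ q)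

Disjoint-sym : Disjoint p q → Disjoint q p
Disjoint-sym {p = p} {q} pq (x , x∈q∩p) = pq (x , subst (x ∈_) (∩-comm q p) x∈q∩p)

Disjoint-antimonoʳ : r ⊆ q → Disjoint p q → Disjoint p r
Disjoint-antimonoʳ {p = p} r⊆q pq (x , x∈) =
  let x∈p , x∈r = x∈p∩q⁻ p _ x∈ in pq (x , x∈p∩q⁺ (x∈p , r⊆q x∈r))

Disjoint-∪ : Disjoint p q → Disjoint p r → Disjoint p (q ∪ r)
Disjoint-∪ {p = p} {q} {r} pq pr (x , x∈) with x∈p∩q⁻ p (q ∪ r) x∈
... | x∈p , x∈q∪r with x∈p∪q⁻ q r x∈q∪r
...   | inj₁ x∈q = pq (x , x∈p∩q⁺ (x∈p , x∈q))
...   | inj₂ x∈r = pr (x , x∈p∩q⁺ (x∈p , x∈r))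

x∈p─q⇒x∉q : ∀ (p q : Subset k) → x ∈ p ─ q → x ∉ q
x∈p─q⇒x∉q (_ ∷ p) (inside  ∷ q) (there x∈) (there x∈q) = x∈p─q⇒x∉q p q x∈ x∈q
x∈p─q⇒x∉q (_ ∷ p) (outside ∷ q) (there x∈) (there x∈q) = x∈p─q⇒x∉q p q x∈ x∈q

Empty[p─q]⇒p⊆q : Empty (p ─ q) → p ⊆ q
Empty[p─q]⇒p⊆q {p = p} {q} empty {x} x∈p with x ∈? q
... | yes x∈q = x∈q
... | no  x∉q = contradiction (x , x∈p∧x∉q⇒x∈p─q x∈p x∉q) empty

x∈p⇒0<∣p∣ : x ∈ p → 0 < ∣ p ∣
x∈p⇒0<∣p∣ here                    = s≤s z≤n
x∈p⇒0<∣p∣ {p = s ∷ p} (there x∈p) = <-≤-trans (x∈p⇒0<∣p∣ x∈p) (∣p∣≤∣x∷p∣ s p)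

∪-least : p ⊆ r → q ⊆ r → p ∪ q ⊆ r
∪-least {p = p} {q = q} p⊆r q⊆r x∈ = [ p⊆r , q⊆r ] (x∈p∪q⁻ p q x∈)

x∈p⇒⁅x⁆⊆p : x ∈ p → ⁅ x ⁆ ⊆ p
x∈p⇒⁅x⁆⊆p {x = x} {p} x∈p y∈⁅x⁆ = subst (_∈ p) (sym (x∈⁅y⁆⇒x≡y x y∈⁅x⁆)) x∈p

∣p∪q∣≤∣p∣+∣q∣ : ∀ (p q : Subset k) → ∣ p ∪ q ∣ ≤ ∣ p ∣ + ∣ q ∣
∣p∪q∣≤∣p∣+∣q∣ []            []            = z≤n
∣p∪q∣≤∣p∣+∣q∣ (inside  ∷ p) (inside  ∷ q) =
  s≤s (≤-trans (∣p∪q∣≤∣p∣+∣q∣ p q) (+-monoʳ-≤ ∣ p ∣ (n≤1+n ∣ q ∣)))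
∣p∪q∣≤∣p∣+∣q∣ (inside  ∷ p) (outside ∷ q) = s≤s (∣p∪q∣≤∣p∣+∣q∣ p q)
∣p∪q∣≤∣p∣+∣q∣ (outside ∷ p) (inside  ∷ q) =
  ≤-trans (s≤s (∣p∪q∣≤∣p∣+∣q∣ p q)) (≤-reflexive (sym (+-suc ∣ p ∣ ∣ q ∣)))
∣p∪q∣≤∣p∣+∣q∣ (outside ∷ p) (outside ∷ q) = ∣p∪q∣≤∣p∣+∣q∣ p q

⊆⋃ : ∀ {ps : List (Subset k)} → p L.∈ ps → p ⊆ ⋃ ps
⊆⋃ {ps = p ∷ ps} (here refl) = p⊆p∪q (⋃ ps)
⊆⋃ {ps = p ∷ ps} (there p∈)  = q⊆p∪q p (⋃ ps) ∘ ⊆⋃ p∈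

∣⋃∣≤ : ∀ {c} (ps : List (Subset k)) → All (λ p → ∣ p ∣ ≤ c) ps → ∣ ⋃ ps ∣ ≤ length ps * c
∣⋃∣≤ {k} []       []         = ≤-reflexive (∣⊥∣≡0 k)
∣⋃∣≤     (p ∷ ps) (∣p∣≤ ∷ ∣ps∣≤) =
  ≤-trans (∣p∪q∣≤∣p∣+∣q∣ p (⋃ ps)) (+-mono-≤ ∣p∣≤ (∣⋃∣≤ ps ∣ps∣≤))

elements : Subset k → List (Fin k)
elements []            = []
elements (inside  ∷ p) = zero ∷ map suc (elements p)
elements (outside ∷ p) = map suc (elements p)

length-elements : ∀ (p : Subset k) → length (elements p) ≡ ∣ p ∣
length-elements []            = refl
length-elements (inside  ∷ p) = cong suc (trans (length-map suc (elements p)) (length-elements p))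
length-elements (outside ∷ p) = trans (length-map suc (elements p)) (length-elements p)

∈-elements⁺ : ∀ {p : Subset k} → x ∈ p → x L.∈ elements p
∈-elements⁺ {p = inside  ∷ p} here        = here refl
∈-elements⁺ {p = inside  ∷ p} (there x∈p) = there (∈-map⁺ suc (∈-elements⁺ x∈p))
∈-elements⁺ {p = outside ∷ p} (there x∈p) = ∈-map⁺ suc (∈-elements⁺ x∈p)

∈-elements⁻ : ∀ (p : Subset k) → x L.∈ elements p → x ∈ p
∈-elements⁻ (inside ∷ p) (here refl) = here
∈-elements⁻ (inside ∷ p) (there x∈) with ∈-map⁻ suc x∈
... | y , y∈ , refl = there (∈-elements⁻ p y∈)
∈-elements⁻ (outside ∷ p) x∈ with ∈-map⁻ suc x∈
... | y , y∈ , refl = there (∈-elements⁻ p y∈)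

length-concatMap-≤ : ∀ {A B : Set} {f : A → List B} {c} (xs : List A) →
  All (λ x → length (f x) ≤ c) xs → length (concatMap f xs) ≤ length xs * c
length-concatMap-≤ []       []               = z≤n
length-concatMap-≤ {f = f} {c} (x ∷ xs) (∣fx∣≤ ∷ ∣fxs∣≤) = begin
  length (f x ++ concatMap f xs)          ≡⟨ length-++ (f x) ⟩
  length (f x) + length (concatMap f xs)  ≤⟨ +-mono-≤ ∣fx∣≤ (length-concatMap-≤ xs ∣fxs∣≤) ⟩
  c + length xs * c                       ∎
  where open ≤-Reasoning

AllPairs-lookup : ∀ {A : Set} {R : A → A → Set} → (∀ {x y} → R x y → R y x) →
  ∀ {xs} → AllPairs R xs → ∀ {i j} → i ≢ j → R (lookup xs i) (lookup xs j)
AllPairs-lookup R-sym (_  ∷ pairs) {zero}  {zero}  0≢0 = contradiction refl 0≢0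
AllPairs-lookup R-sym (Rx ∷ pairs) {zero}  {suc j} _   = All.lookup Rx (∈-lookup j)
AllPairs-lookup R-sym (Rx ∷ pairs) {suc i} {zero}  _   = R-sym (All.lookup Rx (∈-lookup i))
AllPairs-lookup R-sym (_  ∷ pairs) {suc i} {suc j} i≢j =
  AllPairs-lookup R-sym pairs (i≢j ∘ cong suc)

PairwiseDisjoint : ∀ {M} → (Fin M → Subset k) → Set
PairwiseDisjoint p = ∀ {i j} → i ≢ j → Disjoint (p i) (p j)

PairwiseDisjoint-tail : ∀ {M} {p : Fin (suc M) → Subset k} →
  PairwiseDisjoint p → PairwiseDisjoint (p ∘ suc)
PairwiseDisjoint-tail apart i≢j = apart (i≢j ∘ suc-injective)

-- Each point of Z lies in at most one of the disjoint sets p i.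
avoidingIndices : ∀ M (p : Fin M → Subset k) → PairwiseDisjoint p →
  ∀ L (Z : Subset k) → L + ∣ Z ∣ ≤ M →
  Σ (Fin L → Fin M) λ σ → Injective _≡_ _≡_ σ × (∀ a → Disjoint (p (σ a)) Z)
avoidingIndices M       p apart zero    Z _ = (λ ()) , (λ { {()} }) , (λ ())
avoidingIndices (suc M) p apart (suc L) Z (s≤s L+∣Z∣≤M) with nonempty? (p zero ∩ Z)
... | no p₀∩Z≡∅
    with avoidingIndices M (p ∘ suc) (PairwiseDisjoint-tail {p = p} apart) L Z L+∣Z∣≤M
...   | σ , σ-inj , avoids =
  lift 1 σ , lift-injective σ σ-inj 1 , λ { zero → p₀∩Z≡∅ ; (suc a) → avoids a }
avoidingIndices (suc M) p apart (suc L) Z (s≤s L+∣Z∣≤M) | yes (x , x∈p₀∩Z)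
    with avoidingIndices M (p ∘ suc) (PairwiseDisjoint-tail {p = p} apart) (suc L) (Z - x) bound
  where
  bound : suc L + ∣ Z - x ∣ ≤ M
  bound = begin
    suc L + ∣ Z - x ∣  ≡⟨ +-suc L ∣ Z - x ∣ ⟨
    L + suc ∣ Z - x ∣  ≤⟨ +-monoʳ-≤ L (x∈p⇒∣p-x∣<∣p∣ (proj₂ (x∈p∩q⁻ (p zero) Z x∈p₀∩Z))) ⟩
    L + ∣ Z ∣          ≤⟨ L+∣Z∣≤M ⟩
    M                  ∎
    where open ≤-Reasoning
...   | σ , σ-inj , avoids = suc ∘ σ , σ-inj ∘ suc-injective , avoidsZ
  where
  avoidsZ : ∀ a → Disjoint (p (suc (σ a))) Z
  avoidsZ a (y , y∈) with x∈p∩q⁻ (p (suc (σ a))) Z y∈ | y ≟ x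
  ... | y∈pσa , _   | yes refl =
    apart {zero} (λ ()) (y , x∈p∩q⁺ (proj₁ (x∈p∩q⁻ (p zero) Z x∈p₀∩Z) , y∈pσa))
  ... | y∈pσa , y∈Z | no  y≢x  = avoids a (y , x∈p∩q⁺ (y∈pσa , x∈p∧x≢y⇒x∈p-y y∈Z y≢x))

module _ {H : Hypergraph} where
  open Sunflower

  private variable
    ℓ M L : ℕ
    C e f Y : Subset (n H)

  petals-disjoint : (S : Sunflower H ℓ C) → PairwiseDisjoint (petal S)
  petals-disjoint {C = C} S {i} {j} i≢j (x , x∈) =
    let x∈Si─C , x∈Sj─C = x∈p∩q⁻ (petal S i) (petal S j) x∈
        x∈Si∩Sj = x∈p∩q⁺ (p─q⊆p _ C x∈Si─C , p─q⊆p _ C x∈Sj─C)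
    in x∈p─q⇒x∉q _ C x∈Si─C (subst (x ∈_) (pairwise S i j i≢j) x∈Si∩Sj)

  restrict : Sunflower H M C → (σ : Fin L → Fin M) → Injective _≡_ _≡_ σ → Sunflower H L C
  restrict S σ σ-inj = sunflower (member S ∘ σ) (isEdge S ∘ σ) (centerSub S ∘ σ)
    (λ a b a≢b → pairwise S (σ a) (σ b) (a≢b ∘ σ-inj))

  shrinkAvoiding : (S : Sunflower H M C) (Z : Subset (n H)) → L + ∣ Z ∣ ≤ M →
    Σ (Sunflower H L C) λ S′ → Outside S′ Z × (∀ {Y} → Outside S Y → Outside S′ Y)
  shrinkAvoiding {M} {L = L} S Z L+∣Z∣≤M =
    let σ , σ-inj , avoids = avoidingIndices M (petal S) (petals-disjoint S) L Z L+∣Z∣≤M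
    in restrict S σ σ-inj , avoids , (_∘ σ)

  constant : IsEdge H e → Sunflower H ℓ e
  constant {e} e∈H = sunflower (λ _ → e) (λ _ → e∈H) (λ _ → ⊆-refl) (λ _ _ _ → ∩-idem e)

  constant-outside : (e∈H : IsEdge H e) → Outside (constant {ℓ = ℓ} e∈H) Y
  constant-outside {e} _ _ (x , x∈) = x∈p─q⇒x∉q e e (p∩q⊆p _ _ x∈) (p─q⊆p e e (p∩q⊆p _ _ x∈))

  disjointPetals⇒∩≡center : C ⊆ e → C ⊆ f → Disjoint (e ─ C) (f ─ C) → e ∩ f ≡ C
  disjointPetals⇒∩≡center {C} {e} {f} C⊆e C⊆f apart =
    ⊆-antisym e∩f⊆C (λ x∈C → x∈p∩q⁺ (C⊆e x∈C , C⊆f x∈C))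
    where
    e∩f⊆C : e ∩ f ⊆ C
    e∩f⊆C {x} x∈ with x ∈? C | x∈p∩q⁻ e f x∈
    ... | yes x∈C | _         = x∈C
    ... | no  x∉C | x∈e , x∈f = contradiction
      (x , x∈p∩q⁺ (x∈p∧x∉q⇒x∈p─q x∈e x∉C , x∈p∧x∉q⇒x∈p─q x∈f x∉C)) apart

  sunflowerOf : (es : List (Subset (n H))) → All (IsEdge H) es → All (C ⊆_) es →
    AllPairs (λ e f → Disjoint (e ─ C) (f ─ C)) es → Sunflower H (length es) C
  sunflowerOf es edges core pairs = sunflower (lookup es)
    (λ i → All.lookup edges (∈-lookup i)) (λ i → All.lookup core (∈-lookup i))
    (λ i j i≢j → disjointPetals⇒∩≡center (All.lookup core (∈-lookup i))
                   (All.lookup core (∈-lookup j)) (AllPairs-lookup Disjoint-sym pairs i≢j))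

module Greedy (B : Subset k) where

  Fits : Subset k → Subset k → Set
  Fits U e = B ⊆ e × Disjoint (e ─ B) U

  fits? : ∀ U e → Dec (Fits U e)
  fits? U e = (B ⊆? e) ×-dec ¬? (nonempty? ((e ─ B) ∩ U))

  matching : Subset k → List (Subset k) → List (Subset k)
  matching U []       = []
  matching U (e ∷ es) with fits? U e
  ... | yes _ = e ∷ matching (U ∪ (e ─ B)) es
  ... | no  _ = matching U es

  occupied : Subset k → List (Subset k) → Subset k
  occupied U []       = U
  occupied U (e ∷ es) with fits? U e
  ... | yes _ = occupied (U ∪ (e ─ B)) es
  ... | no  _ = occupied U es

  matching⊆ : ∀ U es → All (L._∈ es) (matching U es)
  matching⊆ U []       = []
  matching⊆ U (e ∷ es) with fits? U e
  ... | yes _ = here refl ∷ All.map there (matching⊆ (U ∪ (e ─ B)) es)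
  ... | no  _ = All.map there (matching⊆ U es)

  matching-core : ∀ U es → All (B ⊆_) (matching U es)
  matching-core U []       = []
  matching-core U (e ∷ es) with fits? U e
  ... | yes (B⊆e , _) = B⊆e ∷ matching-core (U ∪ (e ─ B)) es
  ... | no  _         = matching-core U es

  matching-apart : ∀ U es → All (λ f → Disjoint (f ─ B) U) (matching U es)
  matching-apart U []       = []
  matching-apart U (e ∷ es) with fits? U e
  ... | yes (_ , apart) =
    apart ∷ All.map (Disjoint-antimonoʳ (p⊆p∪q (e ─ B))) (matching-apart (U ∪ (e ─ B)) es)
  ... | no  _ = matching-apart U es

  matching-pairwise : ∀ U es → AllPairs (λ e f → Disjoint (e ─ B) (f ─ B)) (matching U es)
  matching-pairwise U []       = []
  matching-pairwise U (e ∷ es) with fits? U e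
  ... | yes _ =
    All.map (Disjoint-sym ∘ Disjoint-antimonoʳ (q⊆p∪q U (e ─ B))) (matching-apart (U ∪ (e ─ B)) es)
    ∷ matching-pairwise (U ∪ (e ─ B)) es
  ... | no  _ = matching-pairwise U es

  ⊆occupied : ∀ U es → U ⊆ occupied U es
  ⊆occupied U []       = ⊆-refl
  ⊆occupied U (e ∷ es) with fits? U e
  ... | yes _ = ⊆occupied (U ∪ (e ─ B)) es ∘ p⊆p∪q (e ─ B)
  ... | no  _ = ⊆occupied U es

  occupied-maximal : ∀ U es {e} → e L.∈ es → B ⊆ e → e ⊆ B ⊎ ∃[ v ] v ∈ e ─ B × v ∈ occupied U es
  occupied-maximal U (e ∷ es) e∈ B⊆e with fits? U e
  occupied-maximal U (e ∷ es) (here refl) B⊆e | yes _ with nonempty? (e ─ B)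
  ... | yes (v , v∈e─B) = inj₂ (v , v∈e─B , ⊆occupied (U ∪ (e ─ B)) es (q⊆p∪q U (e ─ B) v∈e─B))
  ... | no  e─B≡∅       = inj₁ (Empty[p─q]⇒p⊆q e─B≡∅)
  occupied-maximal U (e ∷ es) (here refl) B⊆e | no ¬fits with nonempty? ((e ─ B) ∩ U)
  ... | yes (v , v∈) =
    let v∈e─B , v∈U = x∈p∩q⁻ (e ─ B) U v∈ in inj₂ (v , v∈e─B , ⊆occupied U es v∈U)
  ... | no  apart    = contradiction {A = Fits U e} (B⊆e , apart) ¬fits
  occupied-maximal U (e ∷ es) (there e∈) B⊆e | yes _ = occupied-maximal (U ∪ (e ─ B)) es e∈ B⊆e
  occupied-maximal U (e ∷ es) (there e∈) B⊆e | no  _ = occupied-maximal U es e∈ B⊆e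

  ∣occupied∣≤ : ∀ d U es → (∀ {e} → e L.∈ es → B ⊆ e → ∣ e ─ B ∣ ≤ d) →
    ∣ occupied U es ∣ ≤ ∣ U ∣ + d * length (matching U es)
  ∣occupied∣≤ d U []       _       = m≤m+n ∣ U ∣ _
  ∣occupied∣≤ d U (e ∷ es) bounded with fits? U e
  ... | yes (B⊆e , _) = begin
    ∣ occupied (U ∪ (e ─ B)) es ∣      ≤⟨ ∣occupied∣≤ d (U ∪ (e ─ B)) es (bounded ∘ there) ⟩
    ∣ U ∪ (e ─ B) ∣ + d * s         ≤⟨ +-monoˡ-≤ (d * s) (∣p∪q∣≤∣p∣+∣q∣ U (e ─ B)) ⟩
    ∣ U ∣ + ∣ e ─ B ∣ + d * s       ≤⟨ +-monoˡ-≤ (d * s) (+-monoʳ-≤ ∣ U ∣ ∣e─B∣≤d) ⟩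
    ∣ U ∣ + d + d * s               ≡⟨ +-assoc ∣ U ∣ d (d * s) ⟩
    ∣ U ∣ + (d + d * s)             ≡⟨ cong (∣ U ∣ +_) (*-suc d s) ⟨
    ∣ U ∣ + d * suc s               ∎
    where open ≤-Reasoning
          s = length (matching (U ∪ (e ─ B)) es)
          ∣e─B∣≤d = bounded (here refl) B⊆e
  ... | no  _ = ∣occupied∣≤ d U es (bounded ∘ there)

emptyWindow : ∀ {A : Set} (T : ℕ → ℕ) → (∀ i → T i ≤ T (suc i)) → (g : A → ℕ) →
  ∀ m (xs : List A) → length xs ≤ m →
  ∃[ i ] i ≤ m × All (λ x → g x < T i ⊎ T (suc i) ≤ g x) xs
emptyWindow T T↑ g zero    []       _   = 0 , z≤n , []
emptyWindow T T↑ g (suc m) xs ∣xs∣≤ with all? ((T 1 ≤?_) ∘ g) xs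
... | yes high = 0 , z≤n , All.map inj₂ high
... | no  ¬high with emptyWindow (T ∘ suc) (T↑ ∘ suc) g m (filter ((T 1 ≤?_) ∘ g) xs) shorter
  where
  shorter : length (filter ((T 1 ≤?_) ∘ g) xs) ≤ m
  shorter = ≤-pred (≤-trans (filter-notAll _ xs (¬All⇒Any¬ ((T 1 ≤?_) ∘ g) xs ¬high)) ∣xs∣≤)
...   | i , i≤m , window = suc i , s≤s i≤m , All.tabulate split
  where
  T₁≤ : ∀ j → T 1 ≤ T (suc j)
  T₁≤ zero    = ≤-refl
  T₁≤ (suc j) = ≤-trans (T₁≤ j) (T↑ (suc j))
  split : ∀ {x} → x L.∈ xs → g x < T (suc i) ⊎ T (suc (suc i)) ≤ g x
  split {x} x∈ with T 1 ≤? g x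
  ... | yes T₁≤gx = All.lookup window (∈-filter⁺ ((T 1 ≤?_) ∘ g) x∈ T₁≤gx)
  ... | no  T₁≰gx = inj₁ (<-≤-trans (≰⇒> T₁≰gx) (T₁≤ i))

Bounded : (H : Hypergraph) → ℕ → Subset (n H) → Set
Bounded H d B = ∀ {e} → IsEdge H e → B ⊆ e → ∣ e ─ B ∣ ≤ d

Anchored : (H : Hypergraph) → ℕ → (K A e : Subset (n H)) → Set
Anchored H ℓ K A e = Σ (Subset (n H)) λ C → C ⊆ e × C ⊆ A × Σ (Sunflower H ℓ C) λ S → Outside S K

IsKernelOver : (H : Hypergraph) → ℕ → (B K : Subset (n H)) → Set
IsKernelOver H ℓ B K = ∀ e → IsEdge H e → B ⊆ e → Anchored H ℓ K (B ∪ K) e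

anchoredAtEdge : ∀ {H ℓ K A e} → IsEdge H e → e ⊆ A → Anchored H ℓ K A e
anchoredAtEdge e∈H e⊆A = _ , ⊆-refl , e⊆A , constant e∈H , constant-outside e∈H

bounded-extend : ∀ {H d B v} → v ∉ B → Bounded H (suc d) B → Bounded H d (B ∪ ⁅ v ⁆)
bounded-extend {B = B} {v} v∉B bounded {e} e∈H B∪v⊆e = ≤-pred (begin-strict
  ∣ e ─ (B ∪ ⁅ v ⁆) ∣  ≡⟨ cong ∣_∣ (p─q─r≡p─q∪r e B ⁅ v ⁆) ⟨
  ∣ e ─ B - v ∣        <⟨ x∈p⇒∣p-x∣<∣p∣ (x∈p∧x∉q⇒x∈p─q (B∪v⊆e (q⊆p∪q B _ (x∈⁅x⁆ v))) v∉B) ⟩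
  ∣ e ─ B ∣            ≤⟨ bounded e∈H (B∪v⊆e ∘ p⊆p∪q ⁅ v ⁆) ⟩
  suc _                ∎)
  where open ≤-Reasoning

unionBound : ℕ → ℕ → ℕ → ℕ
unionBound d m t = m * (suc d * t)

-- poorBound d ℓ m t bounds U ∪ K′ when the poor base sets have s(B) < t; the next threshold
-- exceeds t by ℓ + poorBound, enough for a rich base set to avoid K.
mutual
  kernelBound : ℕ → ℕ → ℕ → ℕ
  kernelBound zero    ℓ m = 0
  kernelBound (suc d) ℓ m = max 0 (map (poorBound d ℓ m ∘ threshold d ℓ m) (upTo (suc m)))

  poorBound : ℕ → ℕ → ℕ → ℕ → ℕ
  poorBound d ℓ m t = unionBound d m t + kernelBound d (ℓ + unionBound d m t) (unionBound d m t)

  threshold : ℕ → ℕ → ℕ → ℕ → ℕ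
  threshold d ℓ m zero    = 0
  threshold d ℓ m (suc i) = threshold d ℓ m i + (ℓ + poorBound d ℓ m (threshold d ℓ m i))

poorBound≤kernelBound : ∀ d ℓ m {i} → i ≤ m →
  poorBound d ℓ m (threshold d ℓ m i) ≤ kernelBound (suc d) ℓ m
poorBound≤kernelBound d ℓ m i≤m =
  All.lookup (xs≤max 0 _) (∈-map⁺ (poorBound d ℓ m ∘ threshold d ℓ m) (∈-upTo⁺ (s≤s i≤m)))

CommonKernel : ℕ → Set
CommonKernel d = ∀ ℓ m (H : Hypergraph) (Bs : List (Subset (n H))) →
  length Bs ≤ m → All (Bounded H d) Bs →
  Σ (Subset (n H)) λ K → ∣ K ∣ ≤ kernelBound d ℓ m × All (λ B → IsKernelOver H ℓ B K) Bs

commonKernel₀ : CommonKernel 0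
commonKernel₀ ℓ m H Bs _ bounded = ⊥ , ≤-reflexive (∣⊥∣≡0 (n H)) , All.map kernelOver bounded
  where
  kernelOver : ∀ {B} → Bounded H 0 B → IsKernelOver H ℓ B ⊥
  kernelOver b _ e∈H B⊆e = anchoredAtEdge e∈H
    (p⊆p∪q ⊥ ∘ Empty[p─q]⇒p⊆q (λ (x , x∈) → <⇒≱ (x∈p⇒0<∣p∣ x∈) (b e∈H B⊆e)))

module CommonKernelStep (d : ℕ) (ih : CommonKernel d) (ℓ m : ℕ) (H : Hypergraph)
  (Bs : List (Subset (n H))) (∣Bs∣≤m : length Bs ≤ m) (bounded : All (Bounded H (suc d)) Bs) where

  open Greedy

  matchingSize : Subset (n H) → ℕ
  matchingSize B = length (matching B ⊥ (edges H))

  petalUnion : Subset (n H) → Subset (n H)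
  petalUnion B = occupied B ⊥ (edges H)

  matchingSunflower : ∀ B → Sunflower H (matchingSize B) B
  matchingSunflower B = sunflowerOf (matching B ⊥ (edges H))
    (matching⊆ B ⊥ (edges H)) (matching-core B ⊥ (edges H)) (matching-pairwise B ⊥ (edges H))

  T : ℕ → ℕ
  T = threshold d ℓ m

  window : ∃[ i ] i ≤ m × All (λ B → matchingSize B < T i ⊎ T (suc i) ≤ matchingSize B) Bs
  window = emptyWindow T (λ i → m≤m+n (T i) _) matchingSize m Bs ∣Bs∣≤m

  i t u : ℕ
  i = proj₁ window
  t = T i
  u = unionBound d m t

  poor? : ∀ B → Dec (matchingSize B < t)
  poor? B = matchingSize B <? t

  poor : List (Subset (n H))
  poor = filter poor? Bs

  poor⁻ : ∀ {B} → B L.∈ poor → B L.∈ Bs × matchingSize B < t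
  poor⁻ = ∈-filter⁻ poor? {xs = Bs}

  poor-bounded : ∀ {B} → B L.∈ poor → Bounded H (suc d) B
  poor-bounded = All.lookup bounded ∘ proj₁ ∘ poor⁻

  ∣petalUnion∣≤ : ∀ {B} → B L.∈ poor → ∣ petalUnion B ∣ ≤ suc d * t
  ∣petalUnion∣≤ {B} B∈poor = begin
    ∣ petalUnion B ∣                      ≤⟨ ∣occupied∣≤ B (suc d) ⊥ _ (poor-bounded B∈poor) ⟩
    ∣ ⊥ {n H} ∣ + suc d * matchingSize B  ≡⟨ cong (_+ suc d * matchingSize B) (∣⊥∣≡0 (n H)) ⟩
    suc d * matchingSize B                ≤⟨ *-monoʳ-≤ (suc d) (<⇒≤ (proj₂ (poor⁻ B∈poor))) ⟩
    suc d * t                             ∎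
    where open ≤-Reasoning

  ∣poor∣≤m : length poor ≤ m
  ∣poor∣≤m = ≤-trans (length-filter poor? Bs) ∣Bs∣≤m

  U : Subset (n H)
  U = ⋃ (map petalUnion poor)

  ∣U∣≤u : ∣ U ∣ ≤ u
  ∣U∣≤u = begin
    ∣ U ∣                                       ≤⟨ ∣⋃∣≤ _ (map⁺ (All.tabulate ∣petalUnion∣≤)) ⟩
    length (map petalUnion poor) * (suc d * t)  ≡⟨ cong (_* (suc d * t)) (length-map _ poor) ⟩
    length poor * (suc d * t)                   ≤⟨ *-monoˡ-≤ (suc d * t) ∣poor∣≤m ⟩
    u                                           ∎
    where open ≤-Reasoning

  extensions : Subset (n H) → List (Subset (n H))
  extensions B = map (λ v → B ∪ ⁅ v ⁆) (elements (petalUnion B ─ B))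

  next : List (Subset (n H))
  next = concatMap extensions poor

  ∣next∣≤u : length next ≤ u
  ∣next∣≤u = ≤-trans (length-concatMap-≤ poor (All.tabulate ∣extensions∣≤))
                     (*-monoˡ-≤ (suc d * t) ∣poor∣≤m)
    where
    ∣extensions∣≤ : ∀ {B} → B L.∈ poor → length (extensions B) ≤ suc d * t
    ∣extensions∣≤ {B} B∈poor = begin
      length (extensions B)                 ≡⟨ length-map _ (elements (petalUnion B ─ B)) ⟩
      length (elements (petalUnion B ─ B))  ≡⟨ length-elements (petalUnion B ─ B) ⟩
      ∣ petalUnion B ─ B ∣                  ≤⟨ ∣p─q∣≤∣p∣ (petalUnion B) B ⟩
      ∣ petalUnion B ∣                      ≤⟨ ∣petalUnion∣≤ B∈poor ⟩
      suc d * t                             ∎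
      where open ≤-Reasoning

  next-bounded : All (Bounded H d) next
  next-bounded = concat⁺ (map⁺ (All.tabulate extensions-bounded))
    where
    extensions-bounded : ∀ {B} → B L.∈ poor → All (Bounded H d) (extensions B)
    extensions-bounded {B} B∈poor = map⁺ (All.tabulate λ v∈ →
      bounded-extend (x∈p─q⇒x∉q (petalUnion B) B (∈-elements⁻ _ v∈)) (poor-bounded B∈poor))

  nextKernel : Σ (Subset (n H)) λ K′ →
    ∣ K′ ∣ ≤ kernelBound d (ℓ + u) u × All (λ B → IsKernelOver H (ℓ + u) B K′) next
  nextKernel = ih (ℓ + u) u H next ∣next∣≤u next-bounded

  K′ K : Subset (n H)
  K′ = proj₁ nextKernel
  K = U ∪ K′

  ∣K∣≤ : ∣ K ∣ ≤ poorBound d ℓ m t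
  ∣K∣≤ = ≤-trans (∣p∪q∣≤∣p∣+∣q∣ U K′) (+-mono-≤ ∣U∣≤u (proj₁ (proj₂ nextKernel)))

  richKernel : ∀ {B} → T (suc i) ≤ matchingSize B → IsKernelOver H ℓ B K
  richKernel {B} rich e e∈H B⊆e =
    let S , avoidsK , _ = shrinkAvoiding (matchingSunflower B) K enough
    in B , B⊆e , p⊆p∪q K , S , avoidsK
    where
    enough : ℓ + ∣ K ∣ ≤ matchingSize B
    enough = ≤-trans (+-monoʳ-≤ ℓ ∣K∣≤) (≤-trans (m≤n+m _ t) rich)

  poorKernel : ∀ {B} → B L.∈ Bs → matchingSize B < t → IsKernelOver H ℓ B K
  poorKernel {B} B∈Bs small e e∈H B⊆e with occupied-maximal B ⊥ (edges H) e∈H B⊆e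
  ... | inj₁ e⊆B = anchoredAtEdge e∈H (p⊆p∪q K ∘ e⊆B)
  ... | inj₂ (v , v∈e─B , v∈petalUnion) =
    let C , C⊆e , C⊆B′∪K′ , S , avoidsK′ = All.lookup (proj₂ (proj₂ nextKernel)) B′∈next e e∈H B′⊆e
        S′ , avoidsU , inherits = shrinkAvoiding S U (+-monoʳ-≤ ℓ ∣U∣≤u)
    in C , C⊆e , ⊆-trans C⊆B′∪K′ B′∪K′⊆B∪K , S′ , λ j → Disjoint-∪ (avoidsU j) (inherits avoidsK′ j)
    where
    B∈poor : B L.∈ poor
    B∈poor = ∈-filter⁺ poor? B∈Bs small
    v∈petalUnion─B : v ∈ petalUnion B ─ B
    v∈petalUnion─B = x∈p∧x∉q⇒x∈p─q v∈petalUnion (x∈p─q⇒x∉q e B v∈e─B)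
    B′∈next : B ∪ ⁅ v ⁆ L.∈ next
    B′∈next = ∈-concat⁺′ (∈-map⁺ (λ v → B ∪ ⁅ v ⁆) (∈-elements⁺ v∈petalUnion─B))
                         (∈-map⁺ extensions B∈poor)
    B′⊆e : B ∪ ⁅ v ⁆ ⊆ e
    B′⊆e = ∪-least B⊆e (x∈p⇒⁅x⁆⊆p (p─q⊆p e B v∈e─B))
    v∈U : v ∈ U
    v∈U = ⊆⋃ (∈-map⁺ petalUnion B∈poor) v∈petalUnion
    B′∪K′⊆B∪K : (B ∪ ⁅ v ⁆) ∪ K′ ⊆ B ∪ K
    B′∪K′⊆B∪K = ∪-least (∪-least (p⊆p∪q K) (q⊆p∪q B K ∘ p⊆p∪q K′ ∘ x∈p⇒⁅x⁆⊆p v∈U))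
                        (q⊆p∪q B K ∘ q⊆p∪q U K′)

  result : Σ (Subset (n H)) λ K →
    ∣ K ∣ ≤ kernelBound (suc d) ℓ m × All (λ B → IsKernelOver H ℓ B K) Bs
  result = K , ≤-trans ∣K∣≤ (poorBound≤kernelBound d ℓ m i≤m) , All.tabulate kernel
    where
    i≤m = proj₁ (proj₂ window)
    kernel : ∀ {B} → B L.∈ Bs → IsKernelOver H ℓ B K
    kernel B∈Bs = [ poorKernel B∈Bs , richKernel ] (All.lookup (proj₂ (proj₂ window)) B∈Bs)

commonKernel : ∀ d → CommonKernel d
commonKernel zero    = commonKernel₀
commonKernel (suc d) ℓ m H Bs ∣Bs∣≤m bounded =
  CommonKernelStep.result d (commonKernel d) ℓ m H Bs ∣Bs∣≤m bounded

uniform⇒bounded : ∀ {k H} → Uniform k H → Bounded H k ⊥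
uniform⇒bounded uniform {e} e∈H _ =
  ≤-reflexive (trans (cong ∣_∣ (p─⊥≡p e)) (All.lookup uniform e∈H))

isKernelOver⊥⇒isKernel : ∀ {H ℓ K} → IsKernelOver H ℓ ⊥ K → IsKernel H ℓ K
isKernelOver⊥⇒isKernel {K = K} kernelOver e e∈H =
  let C , C⊆e , C⊆⊥∪K , S , avoidsK = kernelOver e e∈H ⊥⊆
  in C , (λ x∈C → x∈p∩q⁺ (C⊆e x∈C , subst (_ ∈_) (∪-identityˡ K) (C⊆⊥∪K x∈C))) , S , avoidsK

mainTheorem16 : (k : ℕ) → 1 ≤ k →
    Σ (ℕ → ℕ) λ f →
      (H : Hypergraph) → Uniform k H →
        (ℓ : ℕ) → 1 ≤ ℓ →
          Σ (Subset (n H)) λ K → ∣ K ∣ ≤ f ℓ × IsKernel H ℓ K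
mainTheorem16 k _ = (λ ℓ → kernelBound k ℓ 1) , λ H uniform ℓ _ →
  let K , ∣K∣≤ , kernels = commonKernel k ℓ 1 H (⊥ ∷ []) ≤-refl (uniform⇒bounded uniform ∷ [])
  in K , ∣K∣≤ , isKernelOver⊥⇒isKernel (All.head kernels)
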